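{- For every graph $G$ without isolated vertices, $\gamma_t(G)\le\gamma_{t\{2\}}(G)-1$.
   Context: $G=(V,E)$ finite simple graph, $N(v)$ open neighborhood. $\gamma_t(G)$ is the minimum size of a set $D\subseteq V$ such that every vertex of $V$ has a neighbor in $D$. $\gamma_{t\{2\}}(G)$ is the minimum of $\sum_v f(v)$ over $f:V\to\{0,1,2\}$ with $\sum_{w\in N(v)}f(w)\ge 2$ for all $v$. -}

module Defs where

open import Data.Nat using (ℕ; zero; suc; _+_; _≤_)
open import Data.Fin using (Fin; zero; suc)
open import Data.Fin.Subset using (Subset; _∈_; ∣_∣)
open import Data.Product using (Σ; ∃; _×_; _,_)
open import Relation.Nullary using (¬_; Dec)
open import Relation.Binary.PropositionalEquality using (_≡_)
open import Level using (0ℓ)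

record Graph (n : ℕ) : Set₁ where
  field
    Adj     : Fin n → Fin n → Set
    adj?    : ∀ u v → Dec (Adj u v)
    sym     : ∀ {u v} → Adj u v → Adj v u
    irrefl  : ∀ {v} → ¬ Adj v v

open Graph public

NoIsolated : ∀ {n} → Graph n → Set
NoIsolated {n} G = ∀ (v : Fin n) → ∃ λ (w : Fin n) → Adj G v w

IsTotalDominating : ∀ {n} → Graph n → Subset n → Set
IsTotalDominating {n} G D = ∀ (v : Fin n) → ∃ λ (w : Fin n) → Adj G v w × w ∈ D

IsTotalDomNumber : ∀ {n} → Graph n → ℕ → Set
IsTotalDomNumber {n} G k =
  (Σ (Subset n) λ D → IsTotalDominating G D × ∣ D ∣ ≡ k) ×
  (∀ (D : Subset n) → IsTotalDominating G D → k ≤ ∣ D ∣)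

sumFin : ∀ {n} → (Fin n → ℕ) → ℕ
sumFin {zero}  f = 0
sumFin {suc n} f = f zero + sumFin (λ i → f (suc i))

data Two : Set where
  w0 w1 w2 : Two

val : Two → ℕ
val w0 = 0
val w1 = 1
val w2 = 2

neighSum : ∀ {n} → Graph n → (Fin n → Two) → Fin n → ℕ
neighSum {n} G f v = sumFin (λ w → ifAdj (adj? G v w) (val (f w)))
  where
  ifAdj : ∀ {P : Set} → Dec P → ℕ → ℕ
  ifAdj (Relation.Nullary.yes _) x = x
  ifAdj (Relation.Nullary.no _)  _ = 0

IsT2DF : ∀ {n} → Graph n → (Fin n → Two) → Set
IsT2DF {n} G f = ∀ (v : Fin n) → 2 ≤ neighSum G f v

weight : ∀ {n} → (Fin n → Two) → ℕ
weight f = sumFin (λ v → val (f v))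

IsTotal2DomNumber : ∀ {n} → Graph n → ℕ → Set
IsTotal2DomNumber {n} G m =
  (Σ (Fin n → Two) λ f → IsT2DF G f × weight f ≡ m) ×
  (∀ (f : Fin n → Two) → IsT2DF G f → m ≤ weight f)

module Submission where

-- Let f be a total {2}-dominating function of minimum weight m.
-- If n = 0 then k = 0.  Otherwise vertex 0 has neighbourhood weight ≥ 2, so
-- some vertex x has f(x) ≥ 1; lowering f(x) by one gives a function g of
-- weight m - 1.  The support of g is a total dominating set: every vertex v
-- has f-weight ≥ 2 in N(v), so either a neighbour w ≠ x has f(w) ≥ 1 (and
-- g(w) = f(w)), or x itself is a neighbour with f(x) = 2 (and g(x) = 1).
-- Since the support of g has at most weight(g) elements, minimality of k
-- gives k ≤ m - 1.

open import Defs hiding (sym)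
open import Data.Nat using (ℕ; zero; suc; _+_; _≤_; _∸_; z≤n; s≤s; s≤s⁻¹)
open import Data.Nat.Properties using (+-suc; n≤1+n; ≤-trans; module ≤-Reasoning)
open import Data.Fin using (Fin; zero; suc; _≟_)
open import Data.Fin.Properties using (suc-injective)
open import Data.Fin.Subset using (Subset; Side; outside; inside; _∈_; ∣_∣)
open import Data.Vec using ([]; tabulate)
open import Data.Vec.Properties using (lookup∘tabulate; lookup⇒[]=)
open import Data.Product using (∃; _×_; _,_)
open import Data.Sum using (_⊎_; inj₁; inj₂)
open import Data.Empty using (⊥-elim)
open import Relation.Nullary using (yes; no)
open import Relation.Binary.PropositionalEquality using (_≡_; _≢_; refl; sym; cong; cong₂; trans; subst)

sumFin-cong : ∀ {n} {a b : Fin n → ℕ} → (∀ i → a i ≡ b i) → sumFin a ≡ sumFin b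
sumFin-cong {zero}  eq = refl
sumFin-cong {suc n} eq = cong₂ _+_ (eq zero) (sumFin-cong (λ i → eq (suc i)))

sumFin-bump : ∀ {n} (a b : Fin n → ℕ) (x : Fin n) →
  (∀ i → i ≢ x → a i ≡ b i) → a x ≡ suc (b x) → sumFin a ≡ suc (sumFin b)
sumFin-bump a b zero    eq eqx = cong₂ _+_ eqx (sumFin-cong (λ i → eq (suc i) (λ ())))
sumFin-bump a b (suc x) eq eqx =
  trans (cong₂ _+_ (eq zero (λ ()))
                   (sumFin-bump (λ i → a (suc i)) (λ i → b (suc i)) x
                                (λ i i≢x → eq (suc i) (λ e → i≢x (suc-injective e))) eqx))
        (+-suc (b zero) _)

positive-value : ∀ {a b : ℕ} → a ≡ suc b → 1 ≤ a
positive-value refl = s≤s z≤n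

sumFin-positive : ∀ {n} (a : Fin n → ℕ) → 1 ≤ sumFin a → ∃ λ i → 1 ≤ a i
sumFin-positive {zero}  a ()
sumFin-positive {suc n} a h with a zero in eq
... | suc _ = zero , positive-value eq
... | zero with sumFin-positive (λ i → a (suc i)) h
...   | i , p = suc i , p

positive-tail : ∀ {n} (a : Fin (suc n) → ℕ) → 1 ≤ sumFin (λ i → a (suc i)) →
  ∃ λ i → i ≢ zero × 1 ≤ a i
positive-tail a p with sumFin-positive (λ i → a (suc i)) p
... | i , q = suc i , (λ ()) , q

sumFin-two : ∀ {n} (a : Fin n → ℕ) → 2 ≤ sumFin a → (x : Fin n) →
  (∃ λ i → i ≢ x × 1 ≤ a i) ⊎ 2 ≤ a x
sumFin-two a h zero with a zero
... | zero         = inj₁ (positive-tail a (≤-trans (n≤1+n 1) h))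
... | suc zero     = inj₁ (positive-tail a (s≤s⁻¹ h))
... | suc (suc _)  = inj₂ (s≤s (s≤s z≤n))
sumFin-two a h (suc x) with a zero in eq
... | suc _ = inj₁ (zero , (λ ()) , positive-value eq)
... | zero with sumFin-two (λ i → a (suc i)) h x
...   | inj₁ (i , i≢x , p) = inj₁ (suc i , (λ e → i≢x (suc-injective e)) , p)
...   | inj₂ p = inj₂ p

weighted-neighbour : ∀ {n} (G : Graph n) (f : Fin n → Two) (v : Fin n) →
  1 ≤ neighSum G f v → ∃ λ w → Adj G v w × 1 ≤ val (f w)
weighted-neighbour G f v h with sumFin-positive _ h
... | w , hw with adj? G v w
...   | yes vw = w , vw , hw
...   | no _ with hw
...     | ()

heavy-neighbourhood : ∀ {n} (G : Graph n) (f : Fin n → Two) (v : Fin n) →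
  2 ≤ neighSum G f v → (x : Fin n) →
  (∃ λ w → w ≢ x × Adj G v w × 1 ≤ val (f w)) ⊎ (Adj G v x × 2 ≤ val (f x))
heavy-neighbourhood G f v h x with sumFin-two _ h x
... | inj₁ (w , w≢x , hw) with adj? G v w
...   | yes vw = inj₁ (w , w≢x , vw , hw)
...   | no _ with hw
...     | ()
heavy-neighbourhood G f v h x | inj₂ hx with adj? G v x
...   | yes vx = inj₂ (vx , hx)
...   | no _ with hx
...     | ()

pred₂ : Two → Two
pred₂ w0 = w0
pred₂ w1 = w0
pred₂ w2 = w1

val-pred₂ : ∀ t → 1 ≤ val t → val t ≡ suc (val (pred₂ t))
val-pred₂ w1 _ = refl
val-pred₂ w2 _ = refl

pred₂-positive : ∀ t → 2 ≤ val t → 1 ≤ val (pred₂ t)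
pred₂-positive w1 (s≤s ())
pred₂-positive w2 _ = s≤s z≤n

lower : ∀ {n} → Fin n → (Fin n → Two) → Fin n → Two
lower x f i with i ≟ x
... | yes _ = pred₂ (f i)
... | no _  = f i

lower-self : ∀ {n} (x : Fin n) (f : Fin n → Two) → lower x f x ≡ pred₂ (f x)
lower-self x f with x ≟ x
... | yes _   = refl
... | no x≢x  = ⊥-elim (x≢x refl)

lower-other : ∀ {n} (x : Fin n) (f : Fin n → Two) (i : Fin n) → i ≢ x → lower x f i ≡ f i
lower-other x f i i≢x with i ≟ x
... | yes i≡x = ⊥-elim (i≢x i≡x)
... | no _    = refl

weight-lower : ∀ {n} (x : Fin n) (f : Fin n → Two) → 1 ≤ val (f x) →
  weight f ≡ suc (weight (lower x f))
weight-lower x f pos =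
  sumFin-bump (λ i → val (f i)) (λ i → val (lower x f i)) x
    (λ i i≢x → cong val (sym (lower-other x f i i≢x)))
    (trans (val-pred₂ (f x) pos) (cong (λ t → suc (val t)) (sym (lower-self x f))))

mark : Two → Side
mark w0 = outside
mark w1 = inside
mark w2 = inside

support : ∀ {n} → (Fin n → Two) → Subset n
support f = tabulate (λ i → mark (f i))

mark-positive : ∀ t → 1 ≤ val t → mark t ≡ inside
mark-positive w1 _ = refl
mark-positive w2 _ = refl

support-∈ : ∀ {n} (f : Fin n → Two) (i : Fin n) → 1 ≤ val (f i) → i ∈ support f
support-∈ f i pos =
  lookup⇒[]= i (support f) (trans (lookup∘tabulate (λ j → mark (f j)) i) (mark-positive (f i) pos))

-- Each vertex of the support carries weight at least one.
support-size : ∀ {n} (f : Fin n → Two) → ∣ support f ∣ ≤ weight f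
support-size {zero}  f = z≤n
support-size {suc n} f with f zero
... | w0 = support-size (λ i → f (suc i))
... | w1 = s≤s (support-size (λ i → f (suc i)))
... | w2 = s≤s (≤-trans (support-size (λ i → f (suc i))) (n≤1+n _))

lower-dominating : ∀ {n} (G : Graph n) (f : Fin n → Two) (x : Fin n) →
  IsT2DF G f → IsTotalDominating G (support (lower x f))
lower-dominating G f x t2 v with heavy-neighbourhood G f v (t2 v) x
... | inj₁ (w , w≢x , vw , pos) =
  w , vw , support-∈ (lower x f) w (subst (λ t → 1 ≤ val t) (sym (lower-other x f w w≢x)) pos)
... | inj₂ (vx , two) =
  x , vx , support-∈ (lower x f) x (subst (λ t → 1 ≤ val t) (sym (lower-self x f)) (pred₂-positive (f x) two))

mainTheorem14 : ∀ (n : ℕ) (G : Graph n) → NoIsolated G →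
    ∀ (k m : ℕ) → IsTotalDomNumber G k → IsTotal2DomNumber G m →
    k ≤ m ∸ 1
mainTheorem14 zero G _ k m (_ , minimal) _ = ≤-trans (minimal [] (λ ())) z≤n
mainTheorem14 (suc n) G _ k m (_ , minimal) ((f , t2 , refl) , _)
  with weighted-neighbour G f zero (≤-trans (n≤1+n 1) (t2 zero))
... | x , _ , pos = begin
  k                        ≤⟨ minimal (support g) (lower-dominating G f x t2) ⟩
  ∣ support g ∣            ≤⟨ support-size g ⟩
  weight g                 ≡⟨ cong (_∸ 1) (weight-lower x f pos) ⟨
  weight f ∸ 1             ∎
  where
  open ≤-Reasoning
  g : Fin (suc n) → Two
  g = lower x f
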